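{- For every positive integer $n$, $E_{1\to a}(n) = \dfrac{3^n - 1}{2}$.
   Context: Consider the Tower of Hanoi with $3$ pegs (numbered $1,2,3$) and $n$ disks $D_1,\dots,D_n$ of sizes $1,\dots,n$. A state is an assignment of each disk to a peg; on each peg the disks are stacked with sizes decreasing from bottom to top. A legal move takes the top disk of one peg and places it on top of another peg, provided that peg is empty or its top disk is larger than the moved disk. A random solution proceeds by repeatedly choosing the next move uniformly at random among all legal moves in the current state (independently of the past). $E_{1\to a}(n)$ denotes the expected number of random moves needed, starting from the state with all disks on peg $1$, until after at least one move all $n$ disks are for the first time again on a single peg (any of the three pegs). -}

module Defs where

open import Data.Nat as ℕ using (ℕ; zero; suc; _<ᵇ_)
open import Data.Integer using (+_)
open import Data.Fin as Fin using (Fin)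
open import Data.Bool using (Bool; true; false; _∧_; _∨_; if_then_else_; not)
open import Data.Maybe using (Maybe; just; nothing)
import Data.Maybe as Maybe
open import Data.Vec using (Vec; []; _∷_; replicate)
open import Data.List using (List; []; _∷_; concatMap; length; map; allFin; filter)
open import Data.Product using (_×_; _,_)
open import Relation.Nullary.Decidable using (⌊_⌋)
open import Data.Rational using (ℚ; 0ℚ; 1ℚ; _+_; _*_; _/_; _-_; ∣_∣; _<_)
open import Data.Product using (∃-syntax)

-- Pegs are Fin 3 (peg 1 = Fin.zero). A state assigns a peg to each disk;
-- position i of the vector (0-based) is disk D_(i+1), of size i+1.
Peg : Set
Peg = Fin 3

State : ℕ → Set
State n = Vec Peg n

_==_ : Peg → Peg → Bool
p == q = ⌊ p Fin.≟ q ⌋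

topOf : ∀ {n} → State n → Peg → Maybe ℕ
topOf [] p = nothing
topOf (x ∷ xs) p = if x == p then just 0 else Maybe.map suc (topOf xs p)

setAt : ∀ {n} → State n → ℕ → Peg → State n
setAt [] i q = []
setAt (x ∷ xs) zero q = q ∷ xs
setAt (x ∷ xs) (suc i) q = x ∷ setAt xs i q

move : ∀ {n} → State n → Peg → Peg → Maybe (State n)
move s p q with p == q | topOf s p | topOf s q
... | true  | _       | _        = nothing
... | false | nothing | _        = nothing
... | false | just i  | nothing  = just (setAt s i q)
... | false | just i  | just j   = if i <ᵇ j then just (setAt s i q) else nothing

catMaybes : ∀ {A : Set} → List (Maybe A) → List A
catMaybes [] = []
catMaybes (nothing ∷ xs) = catMaybes xs
catMaybes (just x ∷ xs) = x ∷ catMaybes xs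

legalMoves : ∀ {n} → State n → List (State n)
legalMoves s = catMaybes (concatMap (λ p → map (λ q → move s p q) (allFin 3)) (allFin 3))

allOn : ∀ {n} → Peg → State n → Bool
allOn p [] = true
allOn p (x ∷ xs) = (x == p) ∧ allOn p xs

single : ∀ {n} → State n → Bool
single s = allOn Fin.zero s ∨ allOn (Fin.suc Fin.zero) s ∨ allOn (Fin.suc (Fin.suc Fin.zero)) s

start : ∀ n → State n
start n = replicate n Fin.zero

-- Weighted list of states (sub-probability distribution, duplicates allowed).
Dist : ℕ → Set
Dist n = List (State n × ℚ)

stepAll : ∀ {n} → Dist n → Dist n
stepAll [] = []
stepAll {n} ((s , w) ∷ rest) = spread (legalMoves s) (length (legalMoves s)) Data.List.++ stepAll rest
  where
  spread : List (State n) → ℕ → Dist n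
  spread ms zero = []
  spread ms (suc m) = map (λ t → t , w * ((+ 1) / suc m)) ms

keepNonSingle : ∀ {n} → Dist n → Dist n
keepNonSingle [] = []
keepNonSingle ((s , w) ∷ rest) = if single s then keepNonSingle rest else (s , w) ∷ keepNonSingle rest

-- survivors n k : the weighted states after k random moves, restricted to the runs
-- in which no state reached after ≥ 1 move had all disks on one peg.
-- Its total mass is P(T > k), where T is the hitting time from the paper.
survivors : ∀ n → ℕ → Dist n
survivors n zero = (start n , 1ℚ) ∷ []
survivors n (suc k) = keepNonSingle (stepAll (survivors n k))

mass : ∀ {n} → Dist n → ℚ
mass [] = 0ℚ
mass ((s , w) ∷ rest) = w + mass rest

probGreater : ℕ → ℕ → ℚ
probGreater n k = mass (survivors n k)

partialE : ℕ → ℕ → ℚ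
partialE n zero = 0ℚ
partialE n (suc m) = partialE n m + probGreater n m

-- E[T] = Σ_{k ≥ 0} P(T > k) (valid for ℕ ∪ {∞}-valued T) equals q:
-- the series converges in ℚ to q.
ExpectedHittingTimeIs : ℕ → ℚ → Set
ExpectedHittingTimeIs n q =
  ∀ (ε : ℚ) → 0ℚ < ε → ∃[ N ] (∀ m → N ℕ.≤ m → ∣ partialE n m - q ∣ < ε)

module Submission where

-- The walk is the simple random walk on the graph of legal moves. This graph is undirected,
-- so the degree is a stationary measure. Let s_k(v) be the probability that the first k
-- moves from v avoid the three perfect states, and W_k the sum of deg(v) s_k(v) over the
-- non-perfect states v. Stationarity, the degree 2 of the perfect states and the rotation
-- symmetry of the pegs give W_(k+1) + 6 s_(k+1)(start) = W_k, and W_0 = 3^(n+1) - 9, so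
-- telescoping yields  Σ_(j≤k) P(T > j) = (3^n - 1)/2 - W_k/6.  Finally W_k → 0 geometrically:
-- from every state a perfect one can be reached within 2^n - 1 moves, and the walk follows
-- such a path with probability at least 3^(1 - 2^n).

open import Defs
open import Data.Nat using (ℕ; suc; _^_; _∸_)
open import Data.Integer using (+_)
open import Data.Rational using (_/_)

-- A local scope, so that the order on ℚ does not clash with ℕ's _≤_ in mainTheorem3.
module _ where

  open import Data.Bool using (Bool; true; false; if_then_else_; _∧_; _∨_; not)
  open import Data.Bool.Properties using (∨-identityʳ; ∨-comm; ∨-assoc)
  import Data.Fin as Fin
  open import Data.Integer as ℤ using (-[1+_])
  import Data.Integer.Properties as ℤ
  open import Data.List using (List; []; _∷_; length; map; _++_; concatMap; allFin)
  open import Data.Maybe using (Maybe; just; nothing; maybe′)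
  import Data.Maybe as Maybe
  open import Data.Maybe.Properties using (maybe′-map)
  open import Data.Nat as ℕ using (zero; z≤n; s≤s)
  import Data.Nat.Properties as ℕₚ
  open import Data.Product using (Σ; _,_; proj₁; proj₂)
  open import Data.Rational
    using (ℚ; mkℚ; 0ℚ; 1ℚ; ½; _+_; _*_; _-_; -_; _≤_; _<_; ∣_∣; 1/_; NonZero; toℚᵘ; nonNegative; positive)
  open import Data.Rational.Properties
  open import Data.Rational.Unnormalised as ℚᵘ using (mkℚᵘ; *≡*; *≤*)
  import Data.Rational.Unnormalised.Properties as ℚᵘ
  open import Data.Vec using ([]; _∷_; replicate)
  import Data.Vec as Vec
  open import Data.Vec.Properties using (map-replicate)
  open import Relation.Binary.PropositionalEquality
  open import Data.Rational.Solver using (module +-*-Solver)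
  open +-*-Solver

  -- Rational arithmetic

  0≤1 : 0ℚ ≤ 1ℚ
  0≤1 = ≤ᵇ⇒≤ _

  +-nonNeg : ∀ {p q} → 0ℚ ≤ p → 0ℚ ≤ q → 0ℚ ≤ p + q
  +-nonNeg = +-mono-≤

  *-nonNeg : ∀ {p q} → 0ℚ ≤ p → 0ℚ ≤ q → 0ℚ ≤ p * q
  *-nonNeg {p} {q} 0≤p 0≤q = nonNegative⁻¹ _ {{nonNeg*nonNeg⇒nonNeg p {{nonNegative 0≤p}} q {{nonNegative 0≤q}}}}

  p≤q⇒0≤q-p : ∀ {p q} → p ≤ q → 0ℚ ≤ q - p
  p≤q⇒0≤q-p {p} p≤q = ≤-trans (≤-reflexive (sym (+-inverseʳ p))) (+-monoˡ-≤ (- p) p≤q)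

  0≤q-p⇒p≤q : ∀ {p q} → 0ℚ ≤ q - p → p ≤ q
  0≤q-p⇒p≤q {p} {q} 0≤q-p = begin
    p              ≡⟨ sym (+-identityʳ p) ⟩
    p + 0ℚ         ≤⟨ +-monoʳ-≤ p 0≤q-p ⟩
    p + (q - p)    ≡⟨ cong (_+_ p) (+-comm q (- p)) ⟩
    p + (- p + q)  ≡⟨ sym (+-assoc p (- p) q) ⟩
    p - p + q      ≡⟨ cong (_+ q) (+-inverseʳ p) ⟩
    0ℚ + q         ≡⟨ +-identityˡ q ⟩
    q              ∎
    where open ≤-Reasoning

  fromℕ : ℕ → ℚ
  fromℕ k = + k / 1

  toℚᵘ-fromℕ : ∀ k → toℚᵘ (fromℕ k) ℚᵘ.≃ mkℚᵘ (+ k) 0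
  toℚᵘ-fromℕ k = toℚᵘ-fromℚᵘ (mkℚᵘ (+ k) 0)

  fromℕ-nonNeg : ∀ k → 0ℚ ≤ fromℕ k
  fromℕ-nonNeg k = nonNegative⁻¹ _ {{normalize-nonNeg k 1}}

  fromℕ-+ : ∀ a b → fromℕ (a ℕ.+ b) ≡ fromℕ a + fromℕ b
  fromℕ-+ a b = toℚᵘ-injective (ℚᵘ.≃-trans (toℚᵘ-fromℕ (a ℕ.+ b)) (ℚᵘ.≃-trans sum
    (ℚᵘ.≃-sym (ℚᵘ.≃-trans (toℚᵘ-homo-+ (fromℕ a) (fromℕ b)) (ℚᵘ.+-cong (toℚᵘ-fromℕ a) (toℚᵘ-fromℕ b))))))
    where
    sum : mkℚᵘ (+ (a ℕ.+ b)) 0 ℚᵘ.≃ mkℚᵘ (+ a) 0 ℚᵘ.+ mkℚᵘ (+ b) 0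
    sum = *≡* (cong (ℤ._* + 1) (trans (ℤ.pos-+ a b)
      (sym (cong₂ ℤ._+_ (ℤ.*-identityʳ (+ a)) (ℤ.*-identityʳ (+ b))))))

  fromℕ-injective : ∀ {a b} → fromℕ a ≡ fromℕ b → a ≡ b
  fromℕ-injective {a} {b} eq with ℚᵘ.≃-trans (ℚᵘ.≃-sym (toℚᵘ-fromℕ a)) (ℚᵘ.≃-trans (toℚᵘ-cong eq) (toℚᵘ-fromℕ b))
  ... | *≡* a1≡b1 = ℤ.+-injective (trans (sym (ℤ.*-identityʳ (+ a))) (trans a1≡b1 (ℤ.*-identityʳ (+ b))))

  fromℕ-*-inverse : ∀ m → fromℕ (suc m) * (+ 1 / suc m) ≡ 1ℚ
  fromℕ-*-inverse m = toℚᵘ-injective (ℚᵘ.≃-trans (toℚᵘ-homo-* (fromℕ (suc m)) (+ 1 / suc m))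
    (ℚᵘ.≃-trans (ℚᵘ.*-cong (toℚᵘ-fromℕ (suc m)) (toℚᵘ-fromℚᵘ (mkℚᵘ (+ 1) m)))
      (*≡* (trans (ℤ.*-identityʳ (+ suc m ℤ.* + 1)) (trans (ℤ.*-identityʳ (+ suc m))
        (sym (trans (ℤ.*-identityˡ (+ 1 ℤ.* + suc m)) (ℤ.*-identityˡ (+ suc m)))))))))

  /2-fromℕ : ∀ a → + a / 2 ≡ fromℕ a * ½
  /2-fromℕ a = toℚᵘ-injective (ℚᵘ.≃-trans (toℚᵘ-fromℚᵘ (mkℚᵘ (+ a) 1))
    (ℚᵘ.≃-sym (ℚᵘ.≃-trans (toℚᵘ-homo-* (fromℕ a) ½)
      (ℚᵘ.≃-trans (ℚᵘ.*-cong (toℚᵘ-fromℕ a) (toℚᵘ-fromℚᵘ (mkℚᵘ (+ 1) 1)))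
        (*≡* (cong (ℤ._* + 2) (ℤ.*-identityʳ (+ a))))))))

  archimedean : ∀ x → Σ ℕ (λ k → x ≤ fromℕ k)
  archimedean x@(mkℚ (+ k) _ _) = k , toℚᵘ-cancel-≤
    (ℚᵘ.≤-respʳ-≃ (ℚᵘ.≃-sym (toℚᵘ-fromℕ k)) (*≤* (ℤ.*-monoˡ-≤-nonNeg (+ k) (ℤ.+≤+ (s≤s z≤n)))))
  archimedean x@(mkℚ -[1+ _ ] _ _) = 0 , <⇒≤ (negative⁻¹ x)

  pow : ℚ → ℕ → ℚ
  pow r zero    = 1ℚ
  pow r (suc j) = r * pow r j

  module _ {r : ℚ} (0≤r : 0ℚ ≤ r) where

    pow-nonNeg : ∀ j → 0ℚ ≤ pow r j
    pow-nonNeg zero    = 0≤1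
    pow-nonNeg (suc j) = *-nonNeg 0≤r (pow-nonNeg j)

    module _ (r≤1 : r ≤ 1ℚ) where

      pow-suc-≤ : ∀ j → pow r (suc j) ≤ pow r j
      pow-suc-≤ j = ≤-trans (*-monoʳ-≤-nonNeg (pow r j) {{nonNegative (pow-nonNeg j)}} r≤1)
                            (≤-reflexive (*-identityˡ (pow r j)))

      pow-≤1 : ∀ j → pow r j ≤ 1ℚ
      pow-≤1 zero    = ≤-refl
      pow-≤1 (suc j) = ≤-trans (pow-suc-≤ j) (pow-≤1 j)

  bernoulli : ∀ {p} → 0ℚ ≤ p → p ≤ 1ℚ → ∀ j → pow (1ℚ - p) j * (1ℚ + fromℕ j * p) ≤ 1ℚ
  bernoulli {p} 0≤p p≤1 zero    = ≤-reflexive (solve 1 (λ p → con 1ℚ :* (con 1ℚ :+ con 0ℚ :* p) := con 1ℚ) refl p)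
  bernoulli {p} 0≤p p≤1 (suc j) = ≤-trans (0≤q-p⇒p≤q (≤-trans gap (≤-reflexive identity))) (bernoulli 0≤p p≤1 j)
    where
    R i : ℚ
    R = pow (1ℚ - p) j
    i = fromℕ j
    gap : 0ℚ ≤ R * (p * p * (1ℚ + i))
    gap = *-nonNeg (pow-nonNeg (p≤q⇒0≤q-p p≤1) j) (*-nonNeg (*-nonNeg 0≤p 0≤p) (+-nonNeg 0≤1 (fromℕ-nonNeg j)))
    identity : R * (p * p * (1ℚ + i)) ≡ R * (1ℚ + i * p) - (1ℚ - p) * R * (1ℚ + fromℕ (suc j) * p)
    identity = trans (solve 3 (λ R p i → R :* (p :* p :* (con 1ℚ :+ i))
                                     := R :* (con 1ℚ :+ i :* p) :- (con 1ℚ :- p) :* R :* (con 1ℚ :+ (con 1ℚ :+ i) :* p))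
                               refl R p i)
                     (cong (λ x → R * (1ℚ + i * p) - (1ℚ - p) * R * (1ℚ + x * p)) (sym (fromℕ-+ 1 j)))

  ⅓ : ℚ
  ⅓ = + 1 / 3

  pow-⅓-pos : ∀ L → 0ℚ < pow ⅓ L
  pow-⅓-pos zero    = positive⁻¹ 1ℚ
  pow-⅓-pos (suc L) = positive⁻¹ _ {{pos*pos⇒pos ⅓ (pow ⅓ L) {{positive (pow-⅓-pos L)}}}}

  pow-⅓-≤1 : ∀ L → pow ⅓ L ≤ 1ℚ
  pow-⅓-≤1 = pow-≤1 (≤ᵇ⇒≤ _) (≤ᵇ⇒≤ _)

  mean-deficit : ∀ {d x p} → d ≤ fromℕ 3 → x ≤ 1ℚ → d * x ≤ d - p → x ≤ 1ℚ - ⅓ * p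
  mean-deficit {d} {x} {p} d≤3 x≤1 dx≤d-p = 0≤q-p⇒p≤q (begin
    0ℚ                                    ≤⟨ *-nonNeg {⅓} (≤ᵇ⇒≤ _) (p≤q⇒0≤q-p p≤3[1-x]) ⟩
    ⅓ * (fromℕ 3 * (1ℚ - x) - p)          ≡⟨ solve 2 (λ x p → con ⅓ :* (con (fromℕ 3) :* (con 1ℚ :- x) :- p)
                                                         := con 1ℚ :- con ⅓ :* p :- x) refl x p ⟩
    1ℚ - ⅓ * p - x                        ∎)
    where
    open ≤-Reasoning
    p≤3[1-x] : p ≤ fromℕ 3 * (1ℚ - x)
    p≤3[1-x] = begin
      p                    ≤⟨ 0≤q-p⇒p≤q (≤-trans (p≤q⇒0≤q-p dx≤d-p)
                                (≤-reflexive (solve 3 (λ d x p → d :- p :- d :* x := d :* (con 1ℚ :- x) :- p) refl d x p))) ⟩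
      d * (1ℚ - x)         ≤⟨ *-monoʳ-≤-nonNeg (1ℚ - x) {{nonNegative (p≤q⇒0≤q-p x≤1)}} d≤3 ⟩
      fromℕ 3 * (1ℚ - x)   ∎

  geometric-convergence : ∀ {a : ℕ → ℚ} {q C p : ℚ} {D : ℕ} → 0ℚ ≤ C → 0ℚ < p → p ≤ 1ℚ →
    (∀ j k → j ℕ.* D ℕ.≤ k → ∣ a (suc k) - q ∣ ≤ C * pow (1ℚ - p) j) →
    ∀ ε → 0ℚ < ε → Σ ℕ (λ N → ∀ m → N ℕ.≤ m → ∣ a m - q ∣ < ε)
  geometric-convergence {a} {q} {C} {p} {D} 0≤C 0<p p≤1 bound ε 0<ε = suc (j ℕ.* D) , close
    where
    open ≤-Reasoning
    0<εp : 0ℚ < ε * p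
    0<εp = positive⁻¹ (ε * p) {{pos*pos⇒pos ε {{positive 0<ε}} p {{positive 0<p}}}}
    instance
      εp≢0 : NonZero (ε * p)
      εp≢0 = pos⇒nonZero (ε * p) {{positive 0<εp}}
    j : ℕ
    j = proj₁ (archimedean (C * 1/ (ε * p)))
    C≤jεp : C ≤ fromℕ j * (ε * p)
    C≤jεp = begin
      C                                ≡⟨ sym (*-identityʳ C) ⟩
      C * 1ℚ                           ≡⟨ cong (C *_) (sym (*-inverseˡ (ε * p))) ⟩
      C * (1/ (ε * p) * (ε * p))       ≡⟨ sym (*-assoc C (1/ (ε * p)) (ε * p)) ⟩
      C * 1/ (ε * p) * (ε * p)         ≤⟨ *-monoʳ-≤-nonNeg (ε * p) {{nonNegative (<⇒≤ 0<εp)}} (proj₂ (archimedean (C * 1/ (ε * p)))) ⟩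
      fromℕ j * (ε * p)                ∎
    Z : ℚ
    Z = 1ℚ + fromℕ j * p
    0≤Z : 0ℚ ≤ Z
    0≤Z = +-nonNeg 0≤1 (*-nonNeg (fromℕ-nonNeg j) (<⇒≤ 0<p))
    small : C * pow (1ℚ - p) j < ε
    small = *-cancelʳ-<-nonNeg Z {{nonNegative 0≤Z}} (begin-strict
      C * pow (1ℚ - p) j * Z           ≡⟨ *-assoc C _ Z ⟩
      C * (pow (1ℚ - p) j * Z)         ≤⟨ *-monoˡ-≤-nonNeg C {{nonNegative 0≤C}} (bernoulli (<⇒≤ 0<p) p≤1 j) ⟩
      C * 1ℚ                           ≡⟨ *-identityʳ C ⟩
      C                                ≤⟨ C≤jεp ⟩
      fromℕ j * (ε * p)                ≡⟨ sym (+-identityˡ (fromℕ j * (ε * p))) ⟩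
      0ℚ + fromℕ j * (ε * p)           <⟨ +-monoˡ-< (fromℕ j * (ε * p)) 0<ε ⟩
      ε + fromℕ j * (ε * p)            ≡⟨ solve 3 (λ e i p → e :+ i :* (e :* p) := e :* (con 1ℚ :+ i :* p)) refl ε (fromℕ j) p ⟩
      ε * Z                            ∎)
    close : ∀ m → suc (j ℕ.* D) ℕ.≤ m → ∣ a m - q ∣ < ε
    close (suc k) (s≤s jD≤k) = ≤-<-trans (bound j k jD≤k) small

  -- Legal moves

  variable
    n : ℕ

  pattern P₁ = Fin.zero
  pattern P₂ = Fin.suc Fin.zero
  pattern P₃ = Fin.suc (Fin.suc Fin.zero)

  ==-refl : ∀ p → (p == p) ≡ true
  ==-refl P₁ = refl
  ==-refl P₂ = refl
  ==-refl P₃ = refl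

  topOf-head : ∀ p (xs : State n) → topOf (p ∷ xs) p ≡ just 0
  topOf-head p xs = cong (λ b → if b then just 0 else Maybe.map suc (topOf xs p)) (==-refl p)

  topOf-under : ∀ p r (xs : State n) → (r == p) ≡ false →
                topOf (r ∷ xs) p ≡ Maybe.map suc (topOf xs p)
  topOf-under p r xs r≢p = cong (λ b → if b then just 0 else Maybe.map suc (topOf xs p)) r≢p

  -- move only unfolds once its with-scrutinees are abstracted together with their values.
  move-head : ∀ p q (xs : State n) → (p == q) ≡ false → move (p ∷ xs) p q ≡ just (q ∷ xs)
  move-head p q xs p≢q
    with p == q | p≢q | topOf (p ∷ xs) p | topOf-head p xs | topOf xs q | topOf (p ∷ xs) q | topOf-under q p xs p≢q
  ... | false | _ | _ | refl | nothing | _ | refl = refl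
  ... | false | _ | _ | refl | just _  | _ | refl = refl

  move-blocked : ∀ p q (xs : State n) → (q == p) ≡ false → move (q ∷ xs) p q ≡ nothing
  move-blocked p q xs q≢p
    with p == q | topOf xs p | topOf (q ∷ xs) p | topOf-under p q xs q≢p | topOf (q ∷ xs) q | topOf-head q xs
  ... | true  | _       | _ | _    | _ | _    = refl
  ... | false | nothing | _ | refl | _ | refl = refl
  ... | false | just _  | _ | refl | _ | refl = refl

  move-under : ∀ p q r (xs : State n) → (r == p) ≡ false → (r == q) ≡ false →
               move (r ∷ xs) p q ≡ Maybe.map (r ∷_) (move xs p q)
  move-under p q r xs r≢p r≢q
    with p == q | topOf xs p | topOf (r ∷ xs) p | topOf-under p r xs r≢p
                | topOf xs q | topOf (r ∷ xs) q | topOf-under q r xs r≢q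
  ... | true  | _       | _ | _    | _       | _ | _    = refl
  ... | false | nothing | _ | refl | _       | _ | refl = refl
  ... | false | just _  | _ | refl | nothing | _ | refl = refl
  ... | false | just i  | _ | refl | just j  | _ | refl with i ℕ.<ᵇ j
  ...   | true  = refl
  ...   | false = refl

  listSum : {A : Set} → List A → (A → ℚ) → ℚ
  listSum []       f = 0ℚ
  listSum (x ∷ xs) f = f x + listSum xs f

  when : Bool → ℚ → ℚ
  when b x = if b then x else 0ℚ

  data Pair : Set where
    p12 p13 p23 : Pair

  first second : Pair → Peg
  first p12 = P₁
  first p13 = P₁
  first p23 = P₂
  second p12 = P₂
  second p13 = P₃
  second p23 = P₃

  -- Between the two pegs of a pair exactly one move is legal unless both are empty (movable):
  -- the smallest disk lying on one of them passes to the other one (swapTop).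
  movable : Pair → State n → Bool
  movable _   []        = false
  movable p12 (P₁ ∷ xs) = true
  movable p12 (P₂ ∷ xs) = true
  movable p12 (P₃ ∷ xs) = movable p12 xs
  movable p13 (P₁ ∷ xs) = true
  movable p13 (P₂ ∷ xs) = movable p13 xs
  movable p13 (P₃ ∷ xs) = true
  movable p23 (P₁ ∷ xs) = movable p23 xs
  movable p23 (P₂ ∷ xs) = true
  movable p23 (P₃ ∷ xs) = true

  swapTop : Pair → State n → State n
  swapTop _   []        = []
  swapTop p12 (P₁ ∷ xs) = P₂ ∷ xs
  swapTop p12 (P₂ ∷ xs) = P₁ ∷ xs
  swapTop p12 (P₃ ∷ xs) = P₃ ∷ swapTop p12 xs
  swapTop p13 (P₁ ∷ xs) = P₃ ∷ xs
  swapTop p13 (P₂ ∷ xs) = P₂ ∷ swapTop p13 xs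
  swapTop p13 (P₃ ∷ xs) = P₁ ∷ xs
  swapTop p23 (P₁ ∷ xs) = P₁ ∷ swapTop p23 xs
  swapTop p23 (P₂ ∷ xs) = P₃ ∷ xs
  swapTop p23 (P₃ ∷ xs) = P₂ ∷ xs

  pairMoves : Peg → Peg → State n → (State n → ℚ) → ℚ
  pairMoves a b v f = maybe′ f 0ℚ (move v a b) + maybe′ f 0ℚ (move v b a)

  module _ {n} (a b : Peg) (xs : State n) (f : State (suc n) → ℚ) where

    pairMoves-first : (a == b) ≡ false → pairMoves a b (a ∷ xs) f ≡ f (b ∷ xs)
    pairMoves-first a≢b =
      trans (cong₂ (λ s t → maybe′ f 0ℚ s + maybe′ f 0ℚ t) (move-head a b xs a≢b) (move-blocked b a xs a≢b))
            (+-identityʳ _)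

    pairMoves-second : (b == a) ≡ false → pairMoves a b (b ∷ xs) f ≡ f (a ∷ xs)
    pairMoves-second b≢a =
      trans (cong₂ (λ s t → maybe′ f 0ℚ s + maybe′ f 0ℚ t) (move-blocked a b xs b≢a) (move-head b a xs b≢a))
            (+-identityˡ _)

    pairMoves-under : ∀ c → (c == a) ≡ false → (c == b) ≡ false →
                      pairMoves a b (c ∷ xs) f ≡ pairMoves a b xs (λ ys → f (c ∷ ys))
    pairMoves-under c c≢a c≢b =
      cong₂ _+_ (trans (cong (maybe′ f 0ℚ) (move-under a b c xs c≢a c≢b)) (maybe′-map f 0ℚ (c ∷_) (move xs a b)))
                (trans (cong (maybe′ f 0ℚ) (move-under b a c xs c≢b c≢a)) (maybe′-map f 0ℚ (c ∷_) (move xs b a)))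

  pairMoves-swapTop : ∀ pr (v : State n) f →
                      pairMoves (first pr) (second pr) v f ≡ when (movable pr v) (f (swapTop pr v))
  pairMoves-swapTop p12 []        f = refl
  pairMoves-swapTop p13 []        f = refl
  pairMoves-swapTop p23 []        f = refl
  pairMoves-swapTop p12 (P₁ ∷ xs) f = pairMoves-first  P₁ P₂ xs f refl
  pairMoves-swapTop p12 (P₂ ∷ xs) f = pairMoves-second P₁ P₂ xs f refl
  pairMoves-swapTop p12 (P₃ ∷ xs) f = trans (pairMoves-under P₁ P₂ xs f P₃ refl refl) (pairMoves-swapTop p12 xs _)
  pairMoves-swapTop p13 (P₁ ∷ xs) f = pairMoves-first  P₁ P₃ xs f refl
  pairMoves-swapTop p13 (P₂ ∷ xs) f = trans (pairMoves-under P₁ P₃ xs f P₂ refl refl) (pairMoves-swapTop p13 xs _)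
  pairMoves-swapTop p13 (P₃ ∷ xs) f = pairMoves-second P₁ P₃ xs f refl
  pairMoves-swapTop p23 (P₁ ∷ xs) f = trans (pairMoves-under P₂ P₃ xs f P₁ refl refl) (pairMoves-swapTop p23 xs _)
  pairMoves-swapTop p23 (P₂ ∷ xs) f = pairMoves-first  P₂ P₃ xs f refl
  pairMoves-swapTop p23 (P₃ ∷ xs) f = pairMoves-second P₂ P₃ xs f refl

  sumPairs : (Pair → ℚ) → ℚ
  sumPairs F = F p12 + F p13 + F p23

  moveSum : State n → (State n → ℚ) → ℚ
  moveSum v f = sumPairs (λ pr → when (movable pr v) (f (swapTop pr v)))

  degree : State n → ℚ
  degree v = moveSum v (λ _ → 1ℚ)

  listSum-catMaybes : {A : Set} (l : List (Maybe A)) (f : A → ℚ) →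
                      listSum (catMaybes l) f ≡ listSum l (maybe′ f 0ℚ)
  listSum-catMaybes []            f = refl
  listSum-catMaybes (nothing ∷ l) f = trans (listSum-catMaybes l f) (sym (+-identityˡ _))
  listSum-catMaybes (just x ∷ l)  f = cong (_+_ (f x)) (listSum-catMaybes l f)

  legalMoves-sum : (v : State n) (f : State n → ℚ) → listSum (legalMoves v) f ≡ moveSum v f
  legalMoves-sum v f = begin
    listSum (legalMoves v) f
      ≡⟨ listSum-catMaybes (concatMap (λ p → map (move v p) (allFin 3)) (allFin 3)) f ⟩
    0ℚ + (m P₁ P₂ + (m P₁ P₃ + (m P₂ P₁ + (0ℚ + (m P₂ P₃ + (m P₃ P₁ + (m P₃ P₂ + (0ℚ + 0ℚ))))))))
      ≡⟨ solve 6 (λ a b c d e g → con 0ℚ :+ (a :+ (b :+ (d :+ (con 0ℚ :+ (c :+ (e :+ (g :+ (con 0ℚ :+ con 0ℚ))))))))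
                                  := (a :+ d) :+ (b :+ e) :+ (c :+ g))
                 refl (m P₁ P₂) (m P₁ P₃) (m P₂ P₃) (m P₂ P₁) (m P₃ P₁) (m P₃ P₂) ⟩
    pairMoves P₁ P₂ v f + pairMoves P₁ P₃ v f + pairMoves P₂ P₃ v f
      ≡⟨ cong₂ _+_ (cong₂ _+_ (pairMoves-swapTop p12 v f) (pairMoves-swapTop p13 v f)) (pairMoves-swapTop p23 v f) ⟩
    moveSum v f ∎
    where
    open ≡-Reasoning
    m : Peg → Peg → ℚ
    m p q = maybe′ f 0ℚ (move v p q)

  -- The random walk

  -- x / k as it occurs in stepAll, with x ÷ 0 = 0.
  _÷_ : ℚ → ℕ → ℚ
  x ÷ zero  = 0ℚ
  x ÷ suc m = (+ 1 / suc m) * x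

  ÷-mono-≤ : ∀ k {x y} → x ≤ y → x ÷ k ≤ y ÷ k
  ÷-mono-≤ zero    x≤y = ≤-refl
  ÷-mono-≤ (suc m) x≤y = *-monoˡ-≤-nonNeg (+ 1 / suc m) {{normalize-nonNeg 1 (suc m)}} x≤y

  ÷-nonNeg : ∀ k {x} → 0ℚ ≤ x → 0ℚ ≤ x ÷ k
  ÷-nonNeg k 0≤x = ≤-trans (≤-reflexive (sym (0÷ k))) (÷-mono-≤ k 0≤x)
    where
    0÷ : ∀ k → 0ℚ ÷ k ≡ 0ℚ
    0÷ zero    = refl
    0÷ (suc m) = *-zeroʳ (+ 1 / suc m)

  *-÷ : ∀ k c x → (c * x) ÷ k ≡ c * (x ÷ k)
  *-÷ zero    c x = sym (*-zeroʳ c)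
  *-÷ (suc m) c x = solve 3 (λ a c x → a :* (c :* x) := c :* (a :* x)) refl (+ 1 / suc m) c x

  fromℕ-*-÷ : ∀ m x → fromℕ (suc m) * (x ÷ suc m) ≡ x
  fromℕ-*-÷ m x = trans (sym (*-assoc (fromℕ (suc m)) (+ 1 / suc m) x))
                        (trans (cong (_* x) (fromℕ-*-inverse m)) (*-identityˡ x))

  listSum-cong : {A : Set} (L : List A) {f g : A → ℚ} → (∀ t → f t ≡ g t) → listSum L f ≡ listSum L g
  listSum-cong []      f≗g = refl
  listSum-cong (x ∷ L) f≗g = cong₂ _+_ (f≗g x) (listSum-cong L f≗g)

  listSum-mono : {A : Set} (L : List A) {f g : A → ℚ} → (∀ t → f t ≤ g t) → listSum L f ≤ listSum L g
  listSum-mono []      f≤g = ≤-refl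
  listSum-mono (x ∷ L) f≤g = +-mono-≤ (f≤g x) (listSum-mono L f≤g)

  listSum-scale : {A : Set} (L : List A) (c : ℚ) (f : A → ℚ) → listSum L (λ t → c * f t) ≡ c * listSum L f
  listSum-scale []      c f = sym (*-zeroʳ c)
  listSum-scale (x ∷ L) c f =
    trans (cong (_+_ (c * f x)) (listSum-scale L c f)) (sym (*-distribˡ-+ c (f x) (listSum L f)))

  listSum-const : {A : Set} (L : List A) (c : ℚ) → listSum L (λ _ → c) ≡ fromℕ (length L) * c
  listSum-const []      c = sym (*-zeroˡ c)
  listSum-const (x ∷ L) c = begin
    c + listSum L (λ _ → c)        ≡⟨ cong (_+_ c) (listSum-const L c) ⟩
    c + fromℕ (length L) * c       ≡⟨ solve 2 (λ c k → c :+ k :* c := (con 1ℚ :+ k) :* c) refl c (fromℕ (length L)) ⟩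
    (1ℚ + fromℕ (length L)) * c    ≡⟨ cong (_* c) (sym (fromℕ-+ 1 (length L))) ⟩
    fromℕ (suc (length L)) * c     ∎
    where open ≡-Reasoning

  average-cancel : {A : Set} (L : List A) (f : A → ℚ) →
                   fromℕ (length L) * (listSum L f ÷ length L) ≡ listSum L f
  average-cancel []      f = *-zeroˡ 0ℚ
  average-cancel (x ∷ L) f = fromℕ-*-÷ (length L) (listSum (x ∷ L) f)

  average-const : {A : Set} (L : List A) {c : ℚ} → 0ℚ ≤ c → listSum L (λ _ → c) ÷ length L ≤ c
  average-const []      0≤c = 0≤c
  average-const (x ∷ L) {c} 0≤c = ≤-reflexive (begin
    listSum (x ∷ L) (λ _ → c) ÷ length (x ∷ L)   ≡⟨ cong (_÷ length (x ∷ L)) (listSum-const (x ∷ L) c) ⟩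
    (fromℕ (length (x ∷ L)) * c) ÷ length (x ∷ L) ≡⟨ *-÷ (length (x ∷ L)) (fromℕ (length (x ∷ L))) c ⟩
    fromℕ (length (x ∷ L)) * (c ÷ length (x ∷ L)) ≡⟨ fromℕ-*-÷ (length L) c ⟩
    c ∎)
    where open ≡-Reasoning

  afterMove : (State n → ℚ) → State n → ℚ
  afterMove f v = listSum (legalMoves v) f ÷ length (legalMoves v)

  module _ {n} {f g : State n → ℚ} where

    afterMove-cong : (∀ t → f t ≡ g t) → ∀ v → afterMove f v ≡ afterMove g v
    afterMove-cong f≗g v = cong (_÷ length (legalMoves v)) (listSum-cong (legalMoves v) f≗g)

    afterMove-mono : (∀ t → f t ≤ g t) → ∀ v → afterMove f v ≤ afterMove g v
    afterMove-mono f≤g v = ÷-mono-≤ (length (legalMoves v)) (listSum-mono (legalMoves v) f≤g)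

  afterMove-scale : ∀ c (f : State n → ℚ) v → afterMove (λ t → c * f t) v ≡ c * afterMove f v
  afterMove-scale c f v = trans (cong (_÷ length (legalMoves v)) (listSum-scale (legalMoves v) c f))
                                (*-÷ (length (legalMoves v)) c (listSum (legalMoves v) f))

  afterMove-bounded : ∀ {B} {f : State n → ℚ} → 0ℚ ≤ B → (∀ t → f t ≤ B) → ∀ v → afterMove f v ≤ B
  afterMove-bounded 0≤B f≤B v = ≤-trans (afterMove-mono f≤B v) (average-const (legalMoves v) 0≤B)

  afterMove-nonNeg : ∀ {f : State n → ℚ} → (∀ t → 0ℚ ≤ f t) → ∀ v → 0ℚ ≤ afterMove f v
  afterMove-nonNeg 0≤f v = ÷-nonNeg (length (legalMoves v)) (≤-trans (≤-reflexive (sym (listSum-zero (legalMoves v))))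
                                                                    (listSum-mono (legalMoves v) 0≤f))
    where
    listSum-zero : ∀ L → listSum L (λ (_ : State _) → 0ℚ) ≡ 0ℚ
    listSum-zero L = trans (listSum-const L 0ℚ) (*-zeroʳ (fromℕ (length L)))

  degree-length : (v : State n) → degree v ≡ fromℕ (length (legalMoves v))
  degree-length v = begin
    degree v                                 ≡⟨ sym (legalMoves-sum v (λ _ → 1ℚ)) ⟩
    listSum (legalMoves v) (λ _ → 1ℚ)        ≡⟨ listSum-const (legalMoves v) 1ℚ ⟩
    fromℕ (length (legalMoves v)) * 1ℚ       ≡⟨ *-identityʳ _ ⟩
    fromℕ (length (legalMoves v))            ∎
    where open ≡-Reasoning

  degree-*-afterMove : (f : State n → ℚ) (v : State n) → degree v * afterMove f v ≡ moveSum v f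
  degree-*-afterMove f v = begin
    degree v * afterMove f v                                  ≡⟨ cong (_* afterMove f v) (degree-length v) ⟩
    fromℕ (length (legalMoves v)) * afterMove f v             ≡⟨ average-cancel (legalMoves v) f ⟩
    listSum (legalMoves v) f                                  ≡⟨ legalMoves-sum v f ⟩
    moveSum v f                                               ∎
    where open ≡-Reasoning

  nonSingle : (State n → ℚ) → State n → ℚ
  nonSingle f v = if single v then 0ℚ else f v

  step : (State n → ℚ) → State n → ℚ
  step f = afterMove (nonSingle f)

  survival : ℕ → State n → ℚ
  survival zero    _ = 1ℚ
  survival (suc k) = step (survival k)

  module _ {n} {f g : State n → ℚ} where

    nonSingle-mono : (∀ t → f t ≤ g t) → ∀ v → nonSingle f v ≤ nonSingle g v
    nonSingle-mono f≤g v with single v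
    ... | true  = ≤-refl
    ... | false = f≤g v

    step-mono : (∀ t → f t ≤ g t) → ∀ v → step f v ≤ step g v
    step-mono f≤g = afterMove-mono (nonSingle-mono f≤g)

  module _ {n} {f : State n → ℚ} (0≤f : ∀ t → 0ℚ ≤ f t) where

    nonSingle-nonNeg : ∀ v → 0ℚ ≤ nonSingle f v
    nonSingle-nonNeg v with single v
    ... | true  = ≤-refl
    ... | false = 0≤f v

    nonSingle-≤ : ∀ v → nonSingle f v ≤ f v
    nonSingle-≤ v with single v
    ... | true  = 0≤f v
    ... | false = ≤-refl

  nonSingle-scale : ∀ c (f : State n → ℚ) v → nonSingle (λ t → c * f t) v ≡ c * nonSingle f v
  nonSingle-scale c f v with single v
  ... | true  = sym (*-zeroʳ c)
  ... | false = refl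

  step-scale : ∀ c (f : State n → ℚ) v → step (λ t → c * f t) v ≡ c * step f v
  step-scale c f v = trans (afterMove-cong (nonSingle-scale c f) v) (afterMove-scale c (nonSingle f) v)

  survival-nonNeg : ∀ k (v : State n) → 0ℚ ≤ survival k v
  survival-nonNeg zero    v = 0≤1
  survival-nonNeg (suc k) v = afterMove-nonNeg (nonSingle-nonNeg (survival-nonNeg k)) v

  survival-≤1 : ∀ k (v : State n) → survival k v ≤ 1ℚ
  survival-≤1 zero    v = ≤-refl
  survival-≤1 (suc k) v =
    afterMove-bounded 0≤1 (λ t → ≤-trans (nonSingle-≤ (survival-nonNeg k) t) (survival-≤1 k t)) v

  survival-suc-≤ : ∀ k (v : State n) → survival (suc k) v ≤ survival k v
  survival-suc-≤ zero    v = survival-≤1 1 v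
  survival-suc-≤ (suc k) v = step-mono (survival-suc-≤ k) v

  survival-antimono : ∀ i j (v : State n) → survival (i ℕ.+ j) v ≤ survival j v
  survival-antimono zero    j v = ≤-refl
  survival-antimono (suc i) j v = ≤-trans (survival-suc-≤ (i ℕ.+ j) v) (survival-antimono i j v)

  expect : Dist n → (State n → ℚ) → ℚ
  expect []            f = 0ℚ
  expect ((s , w) ∷ D) f = w * f s + expect D f

  expect-++ : (D E : Dist n) (f : State n → ℚ) → expect (D ++ E) f ≡ expect D f + expect E f
  expect-++ []            E f = sym (+-identityˡ _)
  expect-++ ((s , w) ∷ D) E f =
    trans (cong (_+_ (w * f s)) (expect-++ D E f)) (sym (+-assoc (w * f s) (expect D f) (expect E f)))

  expect-uniform : (L : List (State n)) (c : ℚ) (f : State n → ℚ) → expect (map (λ t → t , c) L) f ≡ c * listSum L f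
  expect-uniform []      c f = sym (*-zeroʳ c)
  expect-uniform (t ∷ L) c f =
    trans (cong (_+_ (c * f t)) (expect-uniform L c f)) (sym (*-distribˡ-+ c (f t) (listSum L f)))

  expect-stepAll : (D : Dist n) (f : State n → ℚ) → expect (stepAll D) f ≡ expect D (afterMove f)
  expect-stepAll []            f = refl
  expect-stepAll ((s , w) ∷ D) f with legalMoves s
  ... | []     = trans (expect-stepAll D f)
                       (sym (trans (cong (_+ expect D (afterMove f)) (*-zeroʳ w)) (+-identityˡ _)))
  ... | t ∷ ts = begin
    expect (map (λ u → u , w * c) (t ∷ ts) ++ stepAll D) f   ≡⟨ expect-++ (map (λ u → u , w * c) (t ∷ ts)) (stepAll D) f ⟩
    expect (map (λ u → u , w * c) (t ∷ ts)) f + expect (stepAll D) f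
      ≡⟨ cong₂ _+_ (trans (expect-uniform (t ∷ ts) (w * c) f) (*-assoc w c _)) (expect-stepAll D f) ⟩
    w * (c * listSum (t ∷ ts) f) + expect D (afterMove f)   ∎
    where
    open ≡-Reasoning
    c : ℚ
    c = + 1 / suc (length ts)

  expect-keepNonSingle : (D : Dist n) (f : State n → ℚ) → expect (keepNonSingle D) f ≡ expect D (nonSingle f)
  expect-keepNonSingle []            f = refl
  expect-keepNonSingle ((s , w) ∷ D) f with single s
  ... | true  = trans (expect-keepNonSingle D f)
                      (sym (trans (cong (_+ expect D (nonSingle f)) (*-zeroʳ w)) (+-identityˡ _)))
  ... | false = cong (_+_ (w * f s)) (expect-keepNonSingle D f)

  expect-survivors : ∀ n k j → expect (survivors n k) (survival j) ≡ survival (k ℕ.+ j) (start n)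
  expect-survivors n zero    j = trans (+-identityʳ _) (*-identityˡ _)
  expect-survivors n (suc k) j = begin
    expect (keepNonSingle (stepAll (survivors n k))) (survival j)  ≡⟨ expect-keepNonSingle (stepAll (survivors n k)) (survival j) ⟩
    expect (stepAll (survivors n k)) (nonSingle (survival j))      ≡⟨ expect-stepAll (survivors n k) (nonSingle (survival j)) ⟩
    expect (survivors n k) (survival (suc j))                      ≡⟨ expect-survivors n k (suc j) ⟩
    survival (k ℕ.+ suc j) (start n)                               ≡⟨ cong (λ i → survival i (start n)) (ℕₚ.+-suc k j) ⟩
    survival (suc k ℕ.+ j) (start n)                               ∎
    where open ≡-Reasoning

  mass-expect : (D : Dist n) → mass D ≡ expect D (λ _ → 1ℚ)
  mass-expect []            = refl
  mass-expect ((s , w) ∷ D) = cong₂ _+_ (sym (*-identityʳ w)) (mass-expect D)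

  probGreater-survival : ∀ n k → probGreater n k ≡ survival k (start n)
  probGreater-survival n k = begin
    mass (survivors n k)                   ≡⟨ mass-expect (survivors n k) ⟩
    expect (survivors n k) (survival 0)    ≡⟨ expect-survivors n k 0 ⟩
    survival (k ℕ.+ 0) (start n)           ≡⟨ cong (λ i → survival i (start n)) (ℕₚ.+-identityʳ k) ⟩
    survival k (start n)                   ∎
    where open ≡-Reasoning

  -- Stationarity of the degree

  sumStates : (State n → ℚ) → ℚ
  sumStates {zero}  f = f []
  sumStates {suc n} f = sumStates (λ xs → f (P₁ ∷ xs)) + sumStates (λ xs → f (P₂ ∷ xs)) + sumStates (λ xs → f (P₃ ∷ xs))

  sumStates-cong : {f g : State n → ℚ} → (∀ v → f v ≡ g v) → sumStates f ≡ sumStates g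
  sumStates-cong {zero}  f≗g = f≗g []
  sumStates-cong {suc n} f≗g = cong₂ _+_ (cong₂ _+_ (sumStates-cong (λ xs → f≗g (P₁ ∷ xs)))
                                                     (sumStates-cong (λ xs → f≗g (P₂ ∷ xs))))
                                          (sumStates-cong (λ xs → f≗g (P₃ ∷ xs)))

  sumStates-mono : {f g : State n → ℚ} → (∀ v → f v ≤ g v) → sumStates f ≤ sumStates g
  sumStates-mono {zero}  f≤g = f≤g []
  sumStates-mono {suc n} f≤g = +-mono-≤ (+-mono-≤ (sumStates-mono (λ xs → f≤g (P₁ ∷ xs)))
                                                   (sumStates-mono (λ xs → f≤g (P₂ ∷ xs))))
                                        (sumStates-mono (λ xs → f≤g (P₃ ∷ xs)))

  sumStates-+ : (f g : State n → ℚ) → sumStates (λ v → f v + g v) ≡ sumStates f + sumStates g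
  sumStates-+ {zero}  f g = refl
  sumStates-+ {suc n} f g =
    trans (cong₂ _+_ (cong₂ _+_ (sumStates-+ (λ xs → f (P₁ ∷ xs)) (λ xs → g (P₁ ∷ xs)))
                                (sumStates-+ (λ xs → f (P₂ ∷ xs)) (λ xs → g (P₂ ∷ xs))))
                     (sumStates-+ (λ xs → f (P₃ ∷ xs)) (λ xs → g (P₃ ∷ xs))))
          (solve 6 (λ a b c d e h → (a :+ b) :+ (c :+ d) :+ (e :+ h) := (a :+ c :+ e) :+ (b :+ d :+ h)) refl
                 (sumStates (λ xs → f (P₁ ∷ xs))) (sumStates (λ xs → g (P₁ ∷ xs)))
                 (sumStates (λ xs → f (P₂ ∷ xs))) (sumStates (λ xs → g (P₂ ∷ xs)))
                 (sumStates (λ xs → f (P₃ ∷ xs))) (sumStates (λ xs → g (P₃ ∷ xs))))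

  sumStates-scale : ∀ c (f : State n → ℚ) → sumStates (λ v → c * f v) ≡ c * sumStates f
  sumStates-scale {zero}  c f = refl
  sumStates-scale {suc n} c f =
    trans (cong₂ _+_ (cong₂ _+_ (sumStates-scale c (λ xs → f (P₁ ∷ xs))) (sumStates-scale c (λ xs → f (P₂ ∷ xs))))
                     (sumStates-scale c (λ xs → f (P₃ ∷ xs))))
          (solve 4 (λ c a b d → c :* a :+ c :* b :+ c :* d := c :* (a :+ b :+ d)) refl c
                 (sumStates (λ xs → f (P₁ ∷ xs))) (sumStates (λ xs → f (P₂ ∷ xs))) (sumStates (λ xs → f (P₃ ∷ xs))))

  sumStates-nonNeg : {f : State n → ℚ} → (∀ v → 0ℚ ≤ f v) → 0ℚ ≤ sumStates f
  sumStates-nonNeg {zero}  0≤f = 0≤f []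
  sumStates-nonNeg {suc n} 0≤f = +-nonNeg (+-nonNeg (sumStates-nonNeg (λ xs → 0≤f (P₁ ∷ xs)))
                                                    (sumStates-nonNeg (λ xs → 0≤f (P₂ ∷ xs))))
                                          (sumStates-nonNeg (λ xs → 0≤f (P₃ ∷ xs)))

  sumStates-sumPairs : (F : State n → Pair → ℚ) →
                       sumStates (λ v → sumPairs (F v)) ≡ sumPairs (λ pr → sumStates (λ v → F v pr))
  sumStates-sumPairs F =
    trans (sumStates-+ (λ v → F v p12 + F v p13) (λ v → F v p23))
          (cong (_+ sumStates (λ v → F v p23)) (sumStates-+ (λ v → F v p12) (λ v → F v p13)))

  sumStates-swapTop : ∀ pr (f : State n → ℚ) → sumStates (λ v → f (swapTop pr v)) ≡ sumStates f
  sumStates-swapTop {zero}  pr  f = refl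
  sumStates-swapTop {suc n} p12 f =
    trans (cong (λ z → S₂ + S₁ + z) (sumStates-swapTop p12 (λ xs → f (P₃ ∷ xs))))
          (cong (_+ S₃) (+-comm S₂ S₁))
    where
    S₁ S₂ S₃ : ℚ
    S₁ = sumStates (λ xs → f (P₁ ∷ xs))
    S₂ = sumStates (λ xs → f (P₂ ∷ xs))
    S₃ = sumStates (λ xs → f (P₃ ∷ xs))
  sumStates-swapTop {suc n} p13 f =
    trans (cong (λ z → S₃ + z + S₁) (sumStates-swapTop p13 (λ xs → f (P₂ ∷ xs))))
          (solve 3 (λ a b c → c :+ b :+ a := a :+ b :+ c) refl S₁ S₂ S₃)
    where
    S₁ S₂ S₃ : ℚ
    S₁ = sumStates (λ xs → f (P₁ ∷ xs))
    S₂ = sumStates (λ xs → f (P₂ ∷ xs))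
    S₃ = sumStates (λ xs → f (P₃ ∷ xs))
  sumStates-swapTop {suc n} p23 f =
    trans (cong (λ z → z + S₃ + S₂) (sumStates-swapTop p23 (λ xs → f (P₁ ∷ xs))))
          (solve 3 (λ a b c → a :+ c :+ b := a :+ b :+ c) refl S₁ S₂ S₃)
    where
    S₁ S₂ S₃ : ℚ
    S₁ = sumStates (λ xs → f (P₁ ∷ xs))
    S₂ = sumStates (λ xs → f (P₂ ∷ xs))
    S₃ = sumStates (λ xs → f (P₃ ∷ xs))

  movable-swapTop : ∀ pr (v : State n) → movable pr (swapTop pr v) ≡ movable pr v
  movable-swapTop _   []        = refl
  movable-swapTop p12 (P₁ ∷ xs) = refl
  movable-swapTop p12 (P₂ ∷ xs) = refl
  movable-swapTop p12 (P₃ ∷ xs) = movable-swapTop p12 xs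
  movable-swapTop p13 (P₁ ∷ xs) = refl
  movable-swapTop p13 (P₂ ∷ xs) = movable-swapTop p13 xs
  movable-swapTop p13 (P₃ ∷ xs) = refl
  movable-swapTop p23 (P₁ ∷ xs) = movable-swapTop p23 xs
  movable-swapTop p23 (P₂ ∷ xs) = refl
  movable-swapTop p23 (P₃ ∷ xs) = refl

  sumStates-pairMove : ∀ pr (h : State n → ℚ) →
    sumStates (λ v → when (movable pr v) (h (swapTop pr v))) ≡ sumStates (λ v → when (movable pr v) (h v))
  sumStates-pairMove pr h =
    trans (sumStates-cong (λ v → cong (λ b → when b (h (swapTop pr v))) (sym (movable-swapTop pr v))))
          (sumStates-swapTop pr (λ v → when (movable pr v) (h v)))

  degree-* : (v : State n) (h : State n → ℚ) → degree v * h v ≡ sumPairs (λ pr → when (movable pr v) (h v))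
  degree-* v h = trans (*-distribʳ-+ (h v) (w p12 + w p13) (w p23))
                       (cong₂ _+_ (trans (*-distribʳ-+ (h v) (w p12) (w p13)) (cong₂ _+_ (when-1 p12) (when-1 p13)))
                                  (when-1 p23))
    where
    w : Pair → ℚ
    w pr = when (movable pr v) 1ℚ
    when-1 : ∀ pr → w pr * h v ≡ when (movable pr v) (h v)
    when-1 pr with movable pr v
    ... | true  = *-identityˡ (h v)
    ... | false = *-zeroˡ (h v)

  sumStates-degree-afterMove : (h : State n → ℚ) →
    sumStates (λ v → degree v * afterMove h v) ≡ sumStates (λ v → degree v * h v)
  sumStates-degree-afterMove h = begin
    sumStates (λ v → degree v * afterMove h v)
      ≡⟨ sumStates-cong (λ v → degree-*-afterMove h v) ⟩
    sumStates (λ v → moveSum v h)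
      ≡⟨ sumStates-sumPairs (λ v pr → when (movable pr v) (h (swapTop pr v))) ⟩
    sumPairs (λ pr → sumStates (λ v → when (movable pr v) (h (swapTop pr v))))
      ≡⟨ cong₂ _+_ (cong₂ _+_ (sumStates-pairMove p12 h) (sumStates-pairMove p13 h)) (sumStates-pairMove p23 h) ⟩
    sumPairs (λ pr → sumStates (λ v → when (movable pr v) (h v)))
      ≡⟨ sym (sumStates-sumPairs (λ v pr → when (movable pr v) (h v))) ⟩
    sumStates (λ v → sumPairs (λ pr → when (movable pr v) (h v)))
      ≡⟨ sumStates-cong (λ v → sym (degree-* v h)) ⟩
    sumStates (λ v → degree v * h v) ∎
    where open ≡-Reasoning

  third : Pair → Peg
  third p12 = P₃
  third p13 = P₂
  third p23 = P₁

  movable-allOn : ∀ pr (v : State n) → movable pr v ≡ not (allOn (third pr) v)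
  movable-allOn _   []        = refl
  movable-allOn p12 (P₁ ∷ xs) = refl
  movable-allOn p12 (P₂ ∷ xs) = refl
  movable-allOn p12 (P₃ ∷ xs) = movable-allOn p12 xs
  movable-allOn p13 (P₁ ∷ xs) = refl
  movable-allOn p13 (P₂ ∷ xs) = movable-allOn p13 xs
  movable-allOn p13 (P₃ ∷ xs) = refl
  movable-allOn p23 (P₁ ∷ xs) = movable-allOn p23 xs
  movable-allOn p23 (P₂ ∷ xs) = refl
  movable-allOn p23 (P₃ ∷ xs) = refl

  allOn-replicate : ∀ n p → allOn p (replicate n p) ≡ true
  allOn-replicate zero    p = refl
  allOn-replicate (suc n) p = cong₂ _∧_ (==-refl p) (allOn-replicate n p)

  movable-corner : ∀ n pr → movable pr (replicate n (third pr)) ≡ false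
  movable-corner n pr = trans (movable-allOn pr (replicate n (third pr))) (cong not (allOn-replicate n (third pr)))

  degree-corner : ∀ m p → degree (replicate (suc m) p) ≡ fromℕ 2
  degree-corner m P₁ rewrite movable-corner m p23 = refl
  degree-corner m P₂ rewrite movable-corner m p13 = refl
  degree-corner m P₃ rewrite movable-corner m p12 = refl

  sumStates-zero : sumStates {n} (λ _ → 0ℚ) ≡ 0ℚ
  sumStates-zero {zero}  = refl
  sumStates-zero {suc n} = cong₂ _+_ (cong₂ _+_ (sumStates-zero {n}) (sumStates-zero {n})) (sumStates-zero {n})

  sumStates-allOn : ∀ p (φ : State n → ℚ) → sumStates (λ v → if allOn p v then φ v else 0ℚ) ≡ φ (replicate n p)
  sumStates-allOn {zero}  p  φ = refl
  sumStates-allOn {suc n} P₁ φ =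
    trans (cong₂ _+_ (cong₂ _+_ (sumStates-allOn P₁ (λ xs → φ (P₁ ∷ xs))) (sumStates-zero {n})) (sumStates-zero {n}))
          (trans (+-identityʳ _) (+-identityʳ _))
  sumStates-allOn {suc n} P₂ φ =
    trans (cong₂ _+_ (cong₂ _+_ (sumStates-zero {n}) (sumStates-allOn P₂ (λ xs → φ (P₂ ∷ xs)))) (sumStates-zero {n}))
          (trans (+-identityʳ _) (+-identityˡ _))
  sumStates-allOn {suc n} P₃ φ =
    trans (cong₂ _+_ (cong₂ _+_ (sumStates-zero {n}) (sumStates-zero {n})) (sumStates-allOn P₃ (λ xs → φ (P₃ ∷ xs))))
          (+-identityˡ _)

  cornerSum : (State n → ℚ) → ℚ
  cornerSum {n} f = f (replicate n P₁) + f (replicate n P₂) + f (replicate n P₃)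

  sumStates-single : ∀ {m} (φ : State (suc m) → ℚ) → sumStates (λ v → if single v then φ v else 0ℚ) ≡ cornerSum φ
  sumStates-single φ = cong₂ _+_
    (cong₂ _+_ (trans (sumStates-cong (λ xs → cong (λ b → if b then φ (P₁ ∷ xs) else 0ℚ) (∨-identityʳ (allOn P₁ xs))))
                      (sumStates-allOn P₁ (λ xs → φ (P₁ ∷ xs))))
               (trans (sumStates-cong (λ xs → cong (λ b → if b then φ (P₂ ∷ xs) else 0ℚ) (∨-identityʳ (allOn P₂ xs))))
                      (sumStates-allOn P₂ (λ xs → φ (P₂ ∷ xs)))))
    (sumStates-allOn P₃ (λ xs → φ (P₃ ∷ xs)))

  interiorMass : (State n → ℚ) → ℚ
  interiorMass f = sumStates (λ v → degree v * nonSingle f v)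

  sumStates-degree : ∀ {m} (h : State (suc m) → ℚ) →
                     sumStates (λ v → degree v * h v) ≡ interiorMass h + fromℕ 2 * cornerSum h
  sumStates-degree {m} h = begin
    sumStates (λ v → degree v * h v)
      ≡⟨ sumStates-cong split ⟩
    sumStates (λ v → degree v * nonSingle h v + (if single v then degree v * h v else 0ℚ))
      ≡⟨ sumStates-+ (λ v → degree v * nonSingle h v) (λ v → if single v then degree v * h v else 0ℚ) ⟩
    interiorMass h + sumStates (λ v → if single v then degree v * h v else 0ℚ)
      ≡⟨ cong (_+_ (interiorMass h)) (sumStates-single (λ v → degree v * h v)) ⟩
    interiorMass h + cornerSum (λ v → degree v * h v)
      ≡⟨ cong (λ z → interiorMass h + z) corners ⟩
    interiorMass h + fromℕ 2 * cornerSum h ∎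
    where
    open ≡-Reasoning
    split : ∀ v → degree v * h v ≡ degree v * nonSingle h v + (if single v then degree v * h v else 0ℚ)
    split v with single v
    ... | true  = sym (trans (cong (_+ degree v * h v) (*-zeroʳ (degree v))) (+-identityˡ _))
    ... | false = sym (+-identityʳ _)
    corners : cornerSum (λ v → degree v * h v) ≡ fromℕ 2 * cornerSum h
    corners = trans (cong₂ _+_ (cong₂ _+_ (c P₁) (c P₂)) (c P₃))
                    (solve 4 (λ t a b d → t :* a :+ t :* b :+ t :* d := t :* (a :+ b :+ d)) refl
                           (fromℕ 2) (H P₁) (H P₂) (H P₃))
      where
      H : Peg → ℚ
      H p = h (replicate (suc m) p)
      c : ∀ p → degree (replicate (suc m) p) * H p ≡ fromℕ 2 * H p
      c p = cong (_* H p) (degree-corner m p)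

  interiorMass-step : ∀ {m} (h : State (suc m) → ℚ) →
                      interiorMass (step h) + fromℕ 2 * cornerSum (step h) ≡ interiorMass h
  interiorMass-step h = trans (sym (sumStates-degree (step h))) (sumStates-degree-afterMove (nonSingle h))

  -- Rotating the pegs

  rotate : Peg → Peg
  rotate P₁ = P₂
  rotate P₂ = P₃
  rotate P₃ = P₁

  rotatePair : Pair → Pair
  rotatePair p12 = p23
  rotatePair p13 = p12
  rotatePair p23 = p13

  rotateState : State n → State n
  rotateState = Vec.map rotate

  movable-rotate : ∀ pr (v : State n) → movable (rotatePair pr) (rotateState v) ≡ movable pr v
  movable-rotate _   []        = refl
  movable-rotate p12 (P₁ ∷ xs) = refl
  movable-rotate p12 (P₂ ∷ xs) = refl
  movable-rotate p12 (P₃ ∷ xs) = movable-rotate p12 xs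
  movable-rotate p13 (P₁ ∷ xs) = refl
  movable-rotate p13 (P₂ ∷ xs) = movable-rotate p13 xs
  movable-rotate p13 (P₃ ∷ xs) = refl
  movable-rotate p23 (P₁ ∷ xs) = movable-rotate p23 xs
  movable-rotate p23 (P₂ ∷ xs) = refl
  movable-rotate p23 (P₃ ∷ xs) = refl

  swapTop-rotate : ∀ pr (v : State n) → swapTop (rotatePair pr) (rotateState v) ≡ rotateState (swapTop pr v)
  swapTop-rotate _   []        = refl
  swapTop-rotate p12 (P₁ ∷ xs) = refl
  swapTop-rotate p12 (P₂ ∷ xs) = refl
  swapTop-rotate p12 (P₃ ∷ xs) = cong (P₁ ∷_) (swapTop-rotate p12 xs)
  swapTop-rotate p13 (P₁ ∷ xs) = refl
  swapTop-rotate p13 (P₂ ∷ xs) = cong (P₃ ∷_) (swapTop-rotate p13 xs)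
  swapTop-rotate p13 (P₃ ∷ xs) = refl
  swapTop-rotate p23 (P₁ ∷ xs) = cong (P₂ ∷_) (swapTop-rotate p23 xs)
  swapTop-rotate p23 (P₂ ∷ xs) = refl
  swapTop-rotate p23 (P₃ ∷ xs) = refl

  moveSum-rotate : (v : State n) (f : State n → ℚ) → moveSum (rotateState v) f ≡ moveSum v (λ t → f (rotateState t))
  moveSum-rotate v f =
    trans (cong₂ _+_ (cong₂ _+_ (term p13) (term p23)) (term p12))
          (solve 3 (λ a b c → b :+ c :+ a := a :+ b :+ c) refl (T p12) (T p13) (T p23))
    where
    T : Pair → ℚ
    T pr = when (movable pr v) (f (rotateState (swapTop pr v)))
    term : ∀ pr → when (movable (rotatePair pr) (rotateState v)) (f (swapTop (rotatePair pr) (rotateState v))) ≡ T pr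
    term pr = cong₂ (λ b w → when b (f w)) (movable-rotate pr v) (swapTop-rotate pr v)

  ==-rotate : ∀ x p → (rotate x == rotate p) ≡ (x == p)
  ==-rotate P₁ P₁ = refl
  ==-rotate P₁ P₂ = refl
  ==-rotate P₁ P₃ = refl
  ==-rotate P₂ P₁ = refl
  ==-rotate P₂ P₂ = refl
  ==-rotate P₂ P₃ = refl
  ==-rotate P₃ P₁ = refl
  ==-rotate P₃ P₂ = refl
  ==-rotate P₃ P₃ = refl

  allOn-rotate : ∀ p (v : State n) → allOn (rotate p) (rotateState v) ≡ allOn p v
  allOn-rotate p []       = refl
  allOn-rotate p (x ∷ xs) = cong₂ _∧_ (==-rotate x p) (allOn-rotate p xs)

  single-rotate : (v : State n) → single (rotateState v) ≡ single v
  single-rotate v = begin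
    allOn P₁ (rotateState v) ∨ allOn P₂ (rotateState v) ∨ allOn P₃ (rotateState v)
      ≡⟨ cong₂ _∨_ (allOn-rotate P₃ v) (cong₂ _∨_ (allOn-rotate P₁ v) (allOn-rotate P₂ v)) ⟩
    allOn P₃ v ∨ allOn P₁ v ∨ allOn P₂ v
      ≡⟨ ∨-comm (allOn P₃ v) (allOn P₁ v ∨ allOn P₂ v) ⟩
    (allOn P₁ v ∨ allOn P₂ v) ∨ allOn P₃ v
      ≡⟨ ∨-assoc (allOn P₁ v) (allOn P₂ v) (allOn P₃ v) ⟩
    single v ∎
    where open ≡-Reasoning

  afterMove-rotate : (f : State n → ℚ) (v : State n) →
                     afterMove f (rotateState v) ≡ afterMove (λ t → f (rotateState t)) v
  afterMove-rotate f v = cong₂ _÷_ sums lengths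
    where
    sums : listSum (legalMoves (rotateState v)) f ≡ listSum (legalMoves v) (λ t → f (rotateState t))
    sums = trans (legalMoves-sum (rotateState v) f)
                 (trans (moveSum-rotate v f) (sym (legalMoves-sum v (λ t → f (rotateState t)))))
    lengths : length (legalMoves (rotateState v)) ≡ length (legalMoves v)
    lengths = fromℕ-injective (trans (sym (degree-length (rotateState v)))
                                     (trans (moveSum-rotate v (λ _ → 1ℚ)) (degree-length v)))

  survival-rotate : ∀ k (v : State n) → survival k (rotateState v) ≡ survival k v
  survival-rotate zero    v = refl
  survival-rotate (suc k) v = begin
    afterMove (nonSingle (survival k)) (rotateState v)              ≡⟨ afterMove-rotate (nonSingle (survival k)) v ⟩
    afterMove (λ t → nonSingle (survival k) (rotateState t)) v      ≡⟨ afterMove-cong rotated v ⟩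
    afterMove (nonSingle (survival k)) v                            ∎
    where
    open ≡-Reasoning
    rotated : ∀ t → nonSingle (survival k) (rotateState t) ≡ nonSingle (survival k) t
    rotated t = cong₂ (λ b x → if b then 0ℚ else x) (single-rotate t) (survival-rotate k t)

  cornerSum-survival : ∀ k → cornerSum (survival k) ≡ fromℕ 3 * survival k (start n)
  cornerSum-survival {n} k = begin
    S (replicate n P₁) + S (replicate n P₂) + S (replicate n P₃)
      ≡⟨ cong₂ (λ x y → S (replicate n P₁) + x + y) (rotated P₁) (trans (rotated P₂) (rotated P₁)) ⟩
    S (replicate n P₁) + S (replicate n P₁) + S (replicate n P₁)
      ≡⟨ solve 1 (λ x → x :+ x :+ x := con (fromℕ 3) :* x) refl (S (replicate n P₁)) ⟩
    fromℕ 3 * S (start n) ∎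
    where
    open ≡-Reasoning
    S : State n → ℚ
    S = survival k
    rotated : ∀ p → S (replicate n (rotate p)) ≡ S (replicate n p)
    rotated p = trans (cong S (sym (map-replicate rotate p n))) (survival-rotate k (replicate n p))

  -- The telescoping identity

  sumStates-one : ∀ n → sumStates {n} (λ _ → 1ℚ) ≡ fromℕ (3 ^ n)
  sumStates-one zero    = refl
  sumStates-one (suc n) = begin
    S + S + S                                   ≡⟨ cong (λ x → x + x + x) (sumStates-one n) ⟩
    F + F + F                                   ≡⟨ solve 1 (λ x → x :+ x :+ x := x :+ (x :+ (x :+ con 0ℚ))) refl F ⟩
    F + (F + (F + fromℕ 0))                     ≡⟨ cong (λ x → F + (F + x)) (sym (fromℕ-+ (3 ^ n) 0)) ⟩
    F + (F + fromℕ (3 ^ n ℕ.+ 0))               ≡⟨ cong (_+_ F) (sym (fromℕ-+ (3 ^ n) (3 ^ n ℕ.+ 0))) ⟩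
    F + fromℕ (3 ^ n ℕ.+ (3 ^ n ℕ.+ 0))         ≡⟨ sym (fromℕ-+ (3 ^ n) (3 ^ n ℕ.+ (3 ^ n ℕ.+ 0))) ⟩
    fromℕ (3 ^ n ℕ.+ (3 ^ n ℕ.+ (3 ^ n ℕ.+ 0))) ∎
    where
    open ≡-Reasoning
    S F : ℚ
    S = sumStates {n} (λ _ → 1ℚ)
    F = fromℕ (3 ^ n)

  sumStates-movable : ∀ n pr → sumStates {n} (λ v → when (movable pr v) 1ℚ) + 1ℚ ≡ fromℕ (3 ^ n)
  sumStates-movable n pr = begin
    sumStates {n} (λ v → when (movable pr v) 1ℚ) + 1ℚ
      ≡⟨ cong₂ _+_ (sumStates-cong {n} (λ v → cong (λ b → when b 1ℚ) (movable-allOn pr v)))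
                   (sym (sumStates-allOn {n} (third pr) (λ _ → 1ℚ))) ⟩
    sumStates {n} (λ v → when (not (allOn (third pr) v)) 1ℚ) + sumStates {n} (λ v → when (allOn (third pr) v) 1ℚ)
      ≡⟨ sym (sumStates-+ {n} (λ v → when (not (allOn (third pr) v)) 1ℚ) (λ v → when (allOn (third pr) v) 1ℚ)) ⟩
    sumStates {n} (λ v → when (not (allOn (third pr) v)) 1ℚ + when (allOn (third pr) v) 1ℚ)
      ≡⟨ sumStates-cong {n} (λ v → complement (allOn (third pr) v)) ⟩
    sumStates {n} (λ _ → 1ℚ)
      ≡⟨ sumStates-one n ⟩
    fromℕ (3 ^ n) ∎
    where
    open ≡-Reasoning
    complement : ∀ b → when (not b) 1ℚ + when b 1ℚ ≡ 1ℚ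
    complement true  = refl
    complement false = refl

  interiorMass-one : ∀ m → interiorMass {suc m} (λ _ → 1ℚ) + fromℕ 9 ≡ fromℕ 3 * fromℕ (3 ^ suc m)
  interiorMass-one m = begin
    W + fromℕ 9
      ≡⟨ solve 1 (λ w → w :+ con (fromℕ 9) := w :+ con (fromℕ 2) :* con (fromℕ 3) :+ con 1ℚ :+ con 1ℚ :+ con 1ℚ) refl W ⟩
    W + fromℕ 2 * cornerSum {suc m} (λ _ → 1ℚ) + 1ℚ + 1ℚ + 1ℚ
      ≡⟨ cong (λ z → z + 1ℚ + 1ℚ + 1ℚ) (sym (sumStates-degree {m} (λ _ → 1ℚ))) ⟩
    sumStates {suc m} (λ v → degree v * 1ℚ) + 1ℚ + 1ℚ + 1ℚ
      ≡⟨ cong (λ z → z + 1ℚ + 1ℚ + 1ℚ) (trans (sumStates-cong {suc m} (λ v → *-identityʳ (degree v)))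
                                              (sumStates-sumPairs {suc m} (λ v pr → when (movable pr v) 1ℚ))) ⟩
    M p12 + M p13 + M p23 + 1ℚ + 1ℚ + 1ℚ
      ≡⟨ solve 3 (λ a b c → a :+ b :+ c :+ con 1ℚ :+ con 1ℚ :+ con 1ℚ := (a :+ con 1ℚ) :+ (b :+ con 1ℚ) :+ (c :+ con 1ℚ))
               refl (M p12) (M p13) (M p23) ⟩
    (M p12 + 1ℚ) + (M p13 + 1ℚ) + (M p23 + 1ℚ)
      ≡⟨ cong₂ _+_ (cong₂ _+_ (sumStates-movable (suc m) p12) (sumStates-movable (suc m) p13)) (sumStates-movable (suc m) p23) ⟩
    F + F + F
      ≡⟨ solve 1 (λ x → x :+ x :+ x := con (fromℕ 3) :* x) refl F ⟩
    fromℕ 3 * F ∎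
    where
    open ≡-Reasoning
    W F : ℚ
    W = interiorMass {suc m} (λ _ → 1ℚ)
    F = fromℕ (3 ^ suc m)
    M : Pair → ℚ
    M pr = sumStates {suc m} (λ v → when (movable pr v) 1ℚ)

  partialE-telescope : ∀ m k → fromℕ 6 * partialE (suc m) (suc k) + interiorMass (survival {suc m} k)
                               ≡ fromℕ 6 + interiorMass {suc m} (λ _ → 1ℚ)
  partialE-telescope m zero    = refl
  partialE-telescope m (suc k) = begin
    fromℕ 6 * (E + probGreater (suc m) (suc k)) + W (suc k)
      ≡⟨ cong (λ x → fromℕ 6 * (E + x) + W (suc k)) (probGreater-survival (suc m) (suc k)) ⟩
    fromℕ 6 * (E + S) + W (suc k)
      ≡⟨ solve 3 (λ e s w → con (fromℕ 6) :* (e :+ s) :+ w := con (fromℕ 6) :* e :+ (w :+ con (fromℕ 2) :* (con (fromℕ 3) :* s)))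
               refl E S (W (suc k)) ⟩
    fromℕ 6 * E + (W (suc k) + fromℕ 2 * (fromℕ 3 * S))
      ≡⟨ cong (λ x → fromℕ 6 * E + (W (suc k) + fromℕ 2 * x)) (sym (cornerSum-survival {suc m} (suc k))) ⟩
    fromℕ 6 * E + (W (suc k) + fromℕ 2 * cornerSum {suc m} (survival (suc k)))
      ≡⟨ cong (_+_ (fromℕ 6 * E)) (interiorMass-step {m} (survival k)) ⟩
    fromℕ 6 * E + W k
      ≡⟨ partialE-telescope m k ⟩
    fromℕ 6 + interiorMass {suc m} (λ _ → 1ℚ) ∎
    where
    open ≡-Reasoning
    E S : ℚ
    E = partialE (suc m) (suc k)
    S = survival (suc k) (start (suc m))
    W : ℕ → ℚ
    W k = interiorMass (survival {suc m} k)

  partialE-error : ∀ m k → partialE (suc m) (suc k) + (+ 1 / 6) * interiorMass (survival {suc m} k)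
                           ≡ + (3 ^ suc m ∸ 1) / 2
  partialE-error m k = begin
    E + c * W
      ≡⟨ solve 2 (λ e w → e :+ con c :* w := con c :* (con (fromℕ 6) :* e :+ w)) refl E W ⟩
    c * (fromℕ 6 * E + W)
      ≡⟨ cong (c *_) (partialE-telescope m k) ⟩
    c * (fromℕ 6 + W₁)
      ≡⟨ cong (λ w → c * (fromℕ 6 + w)) W₁-value ⟩
    c * (fromℕ 6 + (fromℕ 3 * F - fromℕ 9))
      ≡⟨ solve 1 (λ f → con c :* (con (fromℕ 6) :+ (con (fromℕ 3) :* f :- con (fromℕ 9))) := (f :- con 1ℚ) :* con ½) refl F ⟩
    (F - 1ℚ) * ½
      ≡⟨ cong (λ x → (x - 1ℚ) * ½) (sym F-pred) ⟩
    (fromℕ (3 ^ suc m ∸ 1) + 1ℚ - 1ℚ) * ½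
      ≡⟨ cong (_* ½) (solve 1 (λ x → x :+ con 1ℚ :- con 1ℚ := x) refl (fromℕ (3 ^ suc m ∸ 1))) ⟩
    fromℕ (3 ^ suc m ∸ 1) * ½
      ≡⟨ sym (/2-fromℕ (3 ^ suc m ∸ 1)) ⟩
    + (3 ^ suc m ∸ 1) / 2 ∎
    where
    open ≡-Reasoning
    c E W W₁ F : ℚ
    c  = + 1 / 6
    E  = partialE (suc m) (suc k)
    W  = interiorMass (survival {suc m} k)
    W₁ = interiorMass {suc m} (λ _ → 1ℚ)
    F  = fromℕ (3 ^ suc m)
    W₁-value : W₁ ≡ fromℕ 3 * F - fromℕ 9
    W₁-value = trans (solve 1 (λ w → w := w :+ con (fromℕ 9) :- con (fromℕ 9)) refl W₁)
                     (cong (_- fromℕ 9) (interiorMass-one m))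
    F-pred : fromℕ (3 ^ suc m ∸ 1) + 1ℚ ≡ F
    F-pred = trans (sym (fromℕ-+ (3 ^ suc m ∸ 1) 1)) (cong fromℕ (ℕₚ.m∸n+n≡m (ℕₚ.m^n>0 3 (suc m))))

  -- Geometric decay

  data Reaches {n} : ℕ → State n → Set where
    here  : ∀ {L v} → single v ≡ true → Reaches L v
    wait  : ∀ {L v} → Reaches L v → Reaches (suc L) v
    along : ∀ {L v} pr → movable pr v ≡ true → Reaches L (swapTop pr v) → Reaches (suc L) v

  degree-≤3 : (v : State n) → degree v ≤ fromℕ 3
  degree-≤3 v = +-mono-≤ (+-mono-≤ (when-≤1 (movable p12 v)) (when-≤1 (movable p13 v))) (when-≤1 (movable p23 v))
    where
    when-≤1 : ∀ b → when b 1ℚ ≤ 1ℚ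
    when-≤1 true  = ≤-refl
    when-≤1 false = 0≤1

  moveTerm-≤ : ∀ {h : State n → ℚ} → (∀ t → h t ≤ 1ℚ) → ∀ pr v →
               when (movable pr v) (h (swapTop pr v)) ≤ when (movable pr v) 1ℚ
  moveTerm-≤ h≤1 pr v with movable pr v
  ... | true  = h≤1 (swapTop pr v)
  ... | false = ≤-refl

  moveSum-deficit : ∀ pr {p} (v : State n) {h : State n → ℚ} → movable pr v ≡ true →
                    (∀ t → h t ≤ 1ℚ) → h (swapTop pr v) ≤ 1ℚ - p → moveSum v h ≤ degree v - p
  moveSum-deficit p12 {p} v m h≤1 hp rewrite m =
    ≤-trans (+-mono-≤ (+-mono-≤ hp (moveTerm-≤ h≤1 p13 v)) (moveTerm-≤ h≤1 p23 v))
            (≤-reflexive (solve 3 (λ p a b → con 1ℚ :- p :+ a :+ b := con 1ℚ :+ a :+ b :- p)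
                                  refl p (when (movable p13 v) 1ℚ) (when (movable p23 v) 1ℚ)))
  moveSum-deficit p13 {p} v m h≤1 hp rewrite m =
    ≤-trans (+-mono-≤ (+-mono-≤ (moveTerm-≤ h≤1 p12 v) hp) (moveTerm-≤ h≤1 p23 v))
            (≤-reflexive (solve 3 (λ p a b → a :+ (con 1ℚ :- p) :+ b := a :+ con 1ℚ :+ b :- p)
                                  refl p (when (movable p12 v) 1ℚ) (when (movable p23 v) 1ℚ)))
  moveSum-deficit p23 {p} v m h≤1 hp rewrite m =
    ≤-trans (+-mono-≤ (+-mono-≤ (moveTerm-≤ h≤1 p12 v) (moveTerm-≤ h≤1 p13 v)) hp)
            (≤-reflexive (solve 3 (λ p a b → a :+ b :+ (con 1ℚ :- p) := a :+ b :+ con 1ℚ :- p)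
                                  refl p (when (movable p12 v) 1ℚ) (when (movable p13 v) 1ℚ)))

  degree-nonNeg : (v : State n) → 0ℚ ≤ degree v
  degree-nonNeg v = +-nonNeg (+-nonNeg (when-nonNeg (movable p12 v)) (when-nonNeg (movable p13 v))) (when-nonNeg (movable p23 v))
    where
    when-nonNeg : ∀ b → 0ℚ ≤ when b 1ℚ
    when-nonNeg true  = 0≤1
    when-nonNeg false = ≤-refl

  reaches-survival : ∀ {L} {v : State n} → Reaches L v → nonSingle (survival L) v ≤ 1ℚ - pow ⅓ L
  reaches-survival {L = L} (here s) rewrite s = p≤q⇒0≤q-p (pow-⅓-≤1 L)
  reaches-survival {L = suc L} {v} (wait r) = begin
    nonSingle (survival (suc L)) v   ≤⟨ nonSingle-mono (survival-suc-≤ L) v ⟩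
    nonSingle (survival L) v         ≤⟨ reaches-survival r ⟩
    1ℚ - pow ⅓ L                     ≤⟨ +-monoʳ-≤ 1ℚ (neg-antimono-≤ (pow-suc-≤ (≤ᵇ⇒≤ _) (≤ᵇ⇒≤ _) L)) ⟩
    1ℚ - pow ⅓ (suc L)               ∎
    where open ≤-Reasoning
  reaches-survival {L = suc L} {v} (along pr m r) =
    ≤-trans (nonSingle-≤ (survival-nonNeg (suc L)) v)
            (mean-deficit (degree-≤3 v) (survival-≤1 (suc L) v)
              (≤-trans (≤-reflexive (degree-*-afterMove (nonSingle (survival L)) v))
                       (moveSum-deficit pr {pow ⅓ L} v m (λ t → ≤-trans (nonSingle-≤ (survival-nonNeg L) t) (survival-≤1 L t))
                                            (reaches-survival r))))

  reaches-cons-single : (xs : State n) (x : Peg) → single xs ≡ true → Reaches 1 (x ∷ xs)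
  reaches-cons-single []        P₁ s = here refl
  reaches-cons-single []        P₂ s = here refl
  reaches-cons-single []        P₃ s = here refl
  reaches-cons-single (P₁ ∷ ys) P₁ s = here s
  reaches-cons-single (P₁ ∷ ys) P₂ s = along p12 refl (here s)
  reaches-cons-single (P₁ ∷ ys) P₃ s = along p13 refl (here s)
  reaches-cons-single (P₂ ∷ ys) P₁ s = along p12 refl (here s)
  reaches-cons-single (P₂ ∷ ys) P₂ s = here s
  reaches-cons-single (P₂ ∷ ys) P₃ s = along p23 refl (here s)
  reaches-cons-single (P₃ ∷ ys) P₁ s = along p13 refl (here s)
  reaches-cons-single (P₃ ∷ ys) P₂ s = along p23 refl (here s)
  reaches-cons-single (P₃ ∷ ys) P₃ s = here s

  double-suc : ∀ L → suc (suc (suc (L ℕ.+ L))) ≡ suc (suc L ℕ.+ suc L)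
  double-suc L = cong (λ i → suc (suc i)) (sym (ℕₚ.+-suc L L))

  -- Every move of the larger disks is preceded by at most one move of the smallest one,
  -- which first clears the two pegs involved.
  reaches-cons : ∀ {L} {xs : State n} → Reaches L xs → ∀ x → Reaches (suc (L ℕ.+ L)) (x ∷ xs)
  reaches-cons {L = L} {xs} (here s) x = pad L
    where
    pad : ∀ K → Reaches (suc (K ℕ.+ K)) (x ∷ xs)
    pad zero    = reaches-cons-single xs x s
    pad (suc K) = subst (λ i → Reaches i (x ∷ xs)) (double-suc K) (wait (wait (pad K)))
  reaches-cons {L = suc L} {xs} (wait r) x =
    subst (λ i → Reaches i (x ∷ xs)) (double-suc L) (wait (wait (reaches-cons r x)))
  reaches-cons {L = suc L} {xs} (along pr m r) x =
    subst (λ i → Reaches i (x ∷ xs)) (double-suc L) (clear pr x m r)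
    where
    clear : ∀ pr x → movable pr xs ≡ true → Reaches L (swapTop pr xs) → Reaches (suc (suc (suc (L ℕ.+ L)))) (x ∷ xs)
    clear p12 P₁ m r = along p13 refl (along p12 m (reaches-cons r P₃))
    clear p12 P₂ m r = along p23 refl (along p12 m (reaches-cons r P₃))
    clear p12 P₃ m r = along p12 m (wait (reaches-cons r P₃))
    clear p13 P₁ m r = along p12 refl (along p13 m (reaches-cons r P₂))
    clear p13 P₂ m r = along p13 m (wait (reaches-cons r P₂))
    clear p13 P₃ m r = along p23 refl (along p13 m (reaches-cons r P₂))
    clear p23 P₁ m r = along p23 m (wait (reaches-cons r P₁))
    clear p23 P₂ m r = along p12 refl (along p23 m (reaches-cons r P₁))
    clear p23 P₃ m r = along p13 refl (along p23 m (reaches-cons r P₁))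

  reachTime : ℕ → ℕ
  reachTime zero    = 0
  reachTime (suc n) = suc (reachTime n ℕ.+ reachTime n)

  reaches : ∀ n (v : State n) → Reaches (reachTime n) v
  reaches zero    []       = here refl
  reaches (suc n) (x ∷ xs) = reaches-cons (reaches n xs) x

  survival-split : ∀ {b M} → 0ℚ ≤ M → (∀ v → nonSingle (survival {n} b) v ≤ M) →
                   ∀ a (v : State n) → survival (suc a ℕ.+ b) v ≤ M * survival (suc a) v
  survival-split {n} {b} {M} 0≤M bound zero v =
    ≤-trans (afterMove-mono scaled v) (≤-reflexive (afterMove-scale M (nonSingle (λ _ → 1ℚ)) v))
    where
    scaled : (t : State n) → nonSingle (survival b) t ≤ M * nonSingle (λ _ → 1ℚ) t
    scaled t with single t | bound t
    ... | true  | _ = ≤-reflexive (sym (*-zeroʳ M))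
    ... | false | s = ≤-trans s (≤-reflexive (sym (*-identityʳ M)))
  survival-split {n} {b} {M} 0≤M bound (suc a) v =
    ≤-trans (step-mono (survival-split 0≤M bound a) v) (≤-reflexive (step-scale M (survival {n} (suc a)) v))

  survival-decay : ∀ {r} d → 0ℚ ≤ r → (∀ v → nonSingle (survival {n} (suc d)) v ≤ r) →
                   ∀ j (v : State n) → nonSingle (survival (j ℕ.* suc d)) v ≤ pow r j
  survival-decay d 0≤r bound zero    v = nonSingle-≤ (λ _ → 0≤1) v
  survival-decay {r = r} d 0≤r bound (suc j) v = begin
    nonSingle (survival (suc d ℕ.+ j ℕ.* suc d)) v
      ≤⟨ nonSingle-mono (survival-split (pow-nonNeg 0≤r j) (survival-decay d 0≤r bound j) d) v ⟩
    nonSingle (λ t → pow r j * survival (suc d) t) v    ≡⟨ nonSingle-scale (pow r j) (survival (suc d)) v ⟩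
    pow r j * nonSingle (survival (suc d)) v            ≤⟨ *-monoˡ-≤-nonNeg (pow r j) {{nonNegative (pow-nonNeg 0≤r j)}} (bound v) ⟩
    pow r j * r                                         ≡⟨ *-comm (pow r j) r ⟩
    pow r (suc j)                                       ∎
    where open ≤-Reasoning

  interiorMass-decay : ∀ {r} d → 0ℚ ≤ r → (∀ v → nonSingle (survival {n} (suc d)) v ≤ r) →
                       ∀ i j → interiorMass (survival {n} (i ℕ.+ j ℕ.* suc d)) ≤ pow r j * sumStates {n} degree
  interiorMass-decay {n} {r} d 0≤r bound i j = begin
    sumStates {n} (λ v → degree v * nonSingle (survival (i ℕ.+ j ℕ.* suc d)) v)
      ≤⟨ sumStates-mono {n} (λ v → *-monoˡ-≤-nonNeg (degree v) {{nonNegative (degree-nonNeg v)}}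
                                 (≤-trans (nonSingle-mono (survival-antimono i (j ℕ.* suc d)) v) (survival-decay {n} d 0≤r bound j v))) ⟩
    sumStates {n} (λ v → degree v * pow r j)
      ≡⟨ trans (sumStates-cong {n} (λ v → *-comm (degree v) (pow r j))) (sumStates-scale {n} (pow r j) degree) ⟩
    pow r j * sumStates {n} degree ∎
    where open ≤-Reasoning

  errorScale-nonNeg : ∀ n → 0ℚ ≤ + 1 / 6 * sumStates {n} degree
  errorScale-nonNeg n = *-nonNeg {+ 1 / 6} (≤ᵇ⇒≤ _) (sumStates-nonNeg {n} degree-nonNeg)

  partialE-error-decay : ∀ m j k → j ℕ.* reachTime (suc m) ℕ.≤ k →
    ∣ partialE (suc m) (suc k) - + (3 ^ suc m ∸ 1) / 2 ∣
      ≤ + 1 / 6 * sumStates {suc m} degree * pow (1ℚ - pow ⅓ (reachTime (suc m))) j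
  partialE-error-decay m j k jD≤k = begin
    ∣ E - q ∣                 ≡⟨ cong (λ x → ∣ E - x ∣) (sym (partialE-error m k)) ⟩
    ∣ E - (E + c * W) ∣       ≡⟨ cong ∣_∣ (solve 2 (λ e x → e :- (e :+ x) := :- x) refl E (c * W)) ⟩
    ∣ - (c * W) ∣             ≡⟨ trans (∣-p∣≡∣p∣ (c * W)) (0≤p⇒∣p∣≡p (*-nonNeg {c} (≤ᵇ⇒≤ _) 0≤W)) ⟩
    c * W                     ≤⟨ *-monoˡ-≤-nonNeg c {{normalize-nonNeg 1 6}} W-decay ⟩
    c * (R * K)               ≡⟨ solve 3 (λ c r k → c :* (r :* k) := c :* k :* r) refl c R K ⟩
    c * K * R                 ∎
    where
    open ≤-Reasoning
    D : ℕ
    D = reachTime (suc m)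
    c E q W R K : ℚ
    c = + 1 / 6
    E = partialE (suc m) (suc k)
    q = + (3 ^ suc m ∸ 1) / 2
    W = interiorMass (survival {suc m} k)
    R = pow (1ℚ - pow ⅓ D) j
    K = sumStates {suc m} degree
    0≤W : 0ℚ ≤ W
    0≤W = sumStates-nonNeg {suc m} (λ v → *-nonNeg (degree-nonNeg v) (nonSingle-nonNeg (survival-nonNeg k) v))
    escape : ∀ v → nonSingle (survival {suc m} D) v ≤ 1ℚ - pow ⅓ D
    escape v = reaches-survival (reaches (suc m) v)
    W-decay : W ≤ R * K
    W-decay = subst (λ i → interiorMass (survival {suc m} i) ≤ R * K) (ℕₚ.m∸n+n≡m jD≤k)
                    (interiorMass-decay {suc m} (reachTime m ℕ.+ reachTime m) (p≤q⇒0≤q-p (pow-⅓-≤1 D)) escape (k ∸ j ℕ.* D) j)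

open import Data.Nat using (_≤_)

mainTheorem3 : (n : ℕ) → 1 ≤ n → ExpectedHittingTimeIs n ((+ (3 ^ n ∸ 1)) / 2)
mainTheorem3 (suc m) _ =
  geometric-convergence {a = partialE (suc m)} (errorScale-nonNeg (suc m)) (pow-⅓-pos D) (pow-⅓-≤1 D) (partialE-error-decay m)
  where
  D : ℕ
  D = reachTime (suc m)
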